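{- Let $m,n\ge1$ be integers, $G=K_m\,\square\,P_n$, and let $\mathcal{C}_0,\dots,\mathcal{C}_n$ be defined below for $\Delta_2^t(G)$ using the vertex order $x_j=(0,j)$, $0\le j\le n-1$. Let $\sigma\in\mathcal{C}_1$. (i) If $\sigma^c=\{(0,0),(0,j)\}$ for some $j\in\{1,\dots,n-1\}$, then $\sigma,\ \sigma\setminus\{(0,j-1)\}\notin\mathcal{C}_j$, and hence $\sigma,\ \sigma\setminus\{(0,j-1)\}\notin\mathcal{C}_n$. (ii) If, for some $i\in\{1,\dots,m-1\}$ and $j\in\{1,\dots,n-1\}$, we have $\{(0,1),(0,2),\dots,(0,j)\}\subseteq\sigma$, $\{(0,0),(i,j)\}\subseteq\sigma^c$ and $\sigma\setminus\{(0,j)\}\in\mathcal{C}_1$, then $\sigma,\ \sigma\setminus\{(0,j)\}\notin\mathcal{C}_n$.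
   Context: For a graph $G$, $\Delta_2^t(G)$ is the simplicial complex whose faces are the $\sigma\subseteq V(G)$ such that $\sigma^c:=V(G)\setminus\sigma$ contains two distinct non-adjacent vertices. $K_m\,\square\,P_n$ has vertex set $\{(i,j)\mid 0\le i\le m-1,\ 0\le j\le n-1\}$, with distinct $(i_1,j_1)\sim(i_2,j_2)$ iff either $i_1=i_2$ and $|j_1-j_2|=1$, or $j_1=j_2$. Given vertices $x_0,\dots,x_{n-1}$, set $\mathcal{C}_0=\Delta_2^t(G)$ and for $0\le j\le n-1$ put $\mathcal{M}_{x_j}=\{\{\sigma\setminus\{x_j\},\sigma\cup\{x_j\}\}\mid \sigma\setminus\{x_j\},\sigma\cup\{x_j\}\in\mathcal{C}_j\}$ and $\mathcal{C}_{j+1}=\{\sigma\in\mathcal{C}_j\mid \sigma\text{ lies in no pair of }\mathcal{M}_{x_j}\}$. -}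

module Defs where

open import Data.Nat using (ℕ; zero; suc; _≤_)
open import Data.Nat.DivMod using (_mod_)
open import Data.Fin using (Fin; toℕ)
open import Data.Fin.Properties using () renaming (_≟_ to _≟F_)
open import Data.Product using (_×_; _,_; ∃)
open import Data.Product.Properties using (≡-dec)
open import Data.Sum using (_⊎_)
open import Data.Bool using (Bool; true; false; if_then_else_)
open import Relation.Nullary using (¬_; does)
open import Relation.Binary.PropositionalEquality using (_≡_; _≢_)

V : ℕ → ℕ → Set
V m n = Fin m × Fin n

VSet : ℕ → ℕ → Set
VSet m n = V m n → Bool

_≟V_ : ∀ {m n} (u v : V m n) → Relation.Nullary.Dec (u ≡ v)
_≟V_ = ≡-dec _≟F_ _≟F_

_∖_ : ∀ {m n} → VSet m n → V m n → VSet m n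
(σ ∖ x) v = if does (v ≟V x) then false else σ v

_∪｛_｝ : ∀ {m n} → VSet m n → V m n → VSet m n
(σ ∪｛ x ｝) v = if does (v ≟V x) then true else σ v

Adj : ∀ {m n} → V m n → V m n → Set
Adj (i₁ , j₁) (i₂ , j₂) =
  (i₁ , j₁) ≢ (i₂ , j₂) ×
  ((i₁ ≡ i₂ × (toℕ j₂ ≡ suc (toℕ j₁) ⊎ toℕ j₁ ≡ suc (toℕ j₂))) ⊎ j₁ ≡ j₂)

-- σ is a face of Δ₂ᵗ(G): σᶜ contains two distinct non-adjacent vertices
Face : ∀ {m n} → VSet m n → Set
Face σ = ∃ λ u → ∃ λ v →
  u ≢ v × σ u ≡ false × σ v ≡ false × ¬ Adj u v

-- The complexes C_k for a vertex order x₀, x₁, … (given as x : ℕ → V):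
-- C₀ = Δ₂ᵗ(G), and σ ∈ C_{k+1} iff σ ∈ C_k and σ lies in no pair
-- {σ∖{x_k}, σ∪{x_k}} of M_{x_k}, i.e. not both σ∖{x_k}, σ∪{x_k} ∈ C_k.
C : ∀ {m n} → (ℕ → V m n) → ℕ → VSet m n → Set
C x zero σ = Face σ
C x (suc k) σ = C x k σ × ¬ (C x k (σ ∖ x k) × C x k (σ ∪｛ x k ｝))

-- The vertex order x_k = (0 , k) for 0 ≤ k ≤ n-1 (here m = suc m', n = suc n').
-- For k ≥ n the value is irrelevant (only C_0,…,C_n are ever used).
xOrd : ∀ {m' n'} → ℕ → V (suc m') (suc n')
xOrd {n' = n'} k = (Fin.zero , k mod (suc n'))

CG : ∀ m' n' → ℕ → VSet (suc m') (suc n') → Set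
CG m' n' = C (xOrd {m'} {n'})

-- A pair {τ∖x_k, τ∪x_k} of M_{x_k} needs τ∖x_k ∈ C₁, which fails as soon as
-- (τ∖x_k) ∪ x₀ is still a face.  So if some vertex v ∉ σ (with v ≠ x₀) is distinct from and
-- non-adjacent to every x_k with 1 ≤ k < K, then σ and σ∖x_K both survive to C_K; when
-- x_K ∈ σ they then form a pair of M_{x_K} and both leave at step K + 1.  In (i) take
-- v = (0,j) and K = j − 1, in (ii) take v = (i,j) and K = j.
module Submission where

open import Defs
open import Data.Nat using (ℕ; suc; _≤_)
open import Data.Fin using (Fin; zero; toℕ; pred)
open import Data.Product using (_×_; _,_)
open import Data.Sum using (_⊎_)
open import Data.Bool using (true; false)
open import Relation.Nullary using (¬_)
open import Relation.Binary.PropositionalEquality using (_≡_)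

open import Data.Nat using (zero; _<_; z≤n; s≤s)
open import Data.Nat.Properties
  using (≤-refl; <-trans; <-asym; <⇒≤; <⇒≢; n<1+n; m≤n⇒m≤1+n; m≤n⇒m<n∨m≡n)
open import Data.Nat.DivMod using (m<n⇒m%n≡m)
open import Data.Fin using (suc; inject₁)
open import Data.Fin.Properties using (toℕ-injective; toℕ-fromℕ<; toℕ<n; toℕ-inject₁)
open import Data.Product using (proj₁; proj₂)
open import Data.Product.Properties using (,-injectiveˡ; ,-injectiveʳ)
open import Data.Sum using (inj₁; inj₂)
open import Data.Bool.Properties using (¬-not)
open import Data.Empty using (⊥; ⊥-elim)
open import Function using (_∘_)
open import Relation.Nullary using (yes; no; contradiction)
open import Relation.Binary.PropositionalEquality using (refl; sym; trans; cong; subst; _≢_; ≢-sym)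

infix 4 _≐_

_≐_ : ∀ {m n} → VSet m n → VSet m n → Set
σ ≐ τ = ∀ v → σ v ≡ τ v

module _ {m n : ℕ} where

  ∖-≐ : ∀ {σ τ : VSet m n} y → σ ≐ τ → σ ∖ y ≐ τ ∖ y
  ∖-≐ y σ≐τ v with v ≟V y
  ... | yes _ = refl
  ... | no _  = σ≐τ v

  ∪-≐ : ∀ {σ τ : VSet m n} y → σ ≐ τ → σ ∪｛ y ｝ ≐ τ ∪｛ y ｝
  ∪-≐ y σ≐τ v with v ≟V y
  ... | yes _ = refl
  ... | no _  = σ≐τ v

  ∖-idem : ∀ (σ : VSet m n) y → σ ∖ y ≐ (σ ∖ y) ∖ y
  ∖-idem σ y v with v ≟V y
  ... | yes _ = refl
  ... | no _  = refl

  ∪-absorb : ∀ (σ : VSet m n) {y} → σ y ≡ true → σ ≐ σ ∪｛ y ｝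
  ∪-absorb σ {y} σy v with v ≟V y
  ... | yes refl = σy
  ... | no _     = refl

  ∖-∪-restore : ∀ (σ : VSet m n) {y} → σ y ≡ true → σ ≐ (σ ∖ y) ∪｛ y ｝
  ∖-∪-restore σ {y} σy v with v ≟V y
  ... | yes refl = σy
  ... | no _     = refl

  ∖-self : ∀ (σ : VSet m n) y → (σ ∖ y) y ≡ false
  ∖-self σ y with y ≟V y
  ... | yes _  = refl
  ... | no y≢y = contradiction refl y≢y

  ∖-∉ : ∀ (σ : VSet m n) y {u} → σ u ≡ false → (σ ∖ y) u ≡ false
  ∖-∉ σ y {u} σu with u ≟V y
  ... | yes _ = refl
  ... | no _  = σu

  ∖-∉⁻ : ∀ (σ : VSet m n) y {u} → (σ ∖ y) u ≡ false → u ≡ y ⊎ σ u ≡ false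
  ∖-∉⁻ σ y {u} σu with u ≟V y
  ... | yes u≡y = inj₁ u≡y
  ... | no _    = inj₂ σu

  ∪-∉ : ∀ (σ : VSet m n) y {u} → u ≢ y → σ u ≡ false → (σ ∪｛ y ｝) u ≡ false
  ∪-∉ σ y {u} u≢y σu with u ≟V y
  ... | yes u≡y = contradiction u≡y u≢y
  ... | no _    = σu

  ∪-∉⁻ : ∀ (σ : VSet m n) y {u} → (σ ∪｛ y ｝) u ≡ false → u ≢ y × σ u ≡ false
  ∪-∉⁻ σ y {u} σu with u ≟V y
  ∪-∉⁻ σ y {u} () | yes _
  ... | no u≢y = u≢y , σu

  Adj-sym : ∀ {u v : V m n} → Adj u v → Adj v u
  Adj-sym (u≢v , inj₁ (i≡ , inj₁ e)) = ≢-sym u≢v , inj₁ (sym i≡ , inj₂ e)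
  Adj-sym (u≢v , inj₁ (i≡ , inj₂ e)) = ≢-sym u≢v , inj₁ (sym i≡ , inj₁ e)
  Adj-sym (u≢v , inj₂ j≡)            = ≢-sym u≢v , inj₂ (sym j≡)

  Adj-inject₁-suc : ∀ {i : Fin m} (j : Fin n) → Adj (i , inject₁ j) (i , suc j)
  Adj-inject₁-suc j =
    (λ e → <⇒≢ (n<1+n _) (trans (sym (toℕ-inject₁ j)) (cong toℕ (,-injectiveʳ e))))
    , inj₁ (refl , inj₁ (cong suc (sym (toℕ-inject₁ j))))

  ¬Adj-diagonal : ∀ {i₁ i₂ : Fin m} {j₁ j₂ : Fin n} →
                  i₁ ≢ i₂ → j₁ ≢ j₂ → ¬ Adj (i₁ , j₁) (i₂ , j₂)
  ¬Adj-diagonal i₁≢i₂ _ (_ , inj₁ (i₁≡i₂ , _)) = i₁≢i₂ i₁≡i₂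
  ¬Adj-diagonal _ j₁≢j₂ (_ , inj₂ j₁≡j₂)       = j₁≢j₂ j₁≡j₂

  ¬Adj-apart : ∀ {i₁ i₂ : Fin m} {j₁ j₂ : Fin n} →
               suc (toℕ j₁) < toℕ j₂ → ¬ Adj (i₁ , j₁) (i₂ , j₂)
  ¬Adj-apart far (_ , inj₁ (_ , inj₁ e)) = <⇒≢ far (sym e)
  ¬Adj-apart far (_ , inj₁ (_ , inj₂ e)) = <-asym (<-trans (n<1+n _) far) (subst (toℕ _ <_) (sym e) (n<1+n _))
  ¬Adj-apart far (_ , inj₂ refl)         = <⇒≢ (<-trans (n<1+n _) far) refl

  Face-∖ : ∀ {σ : VSet m n} y → Face σ → Face (σ ∖ y)
  Face-∖ {σ} y (u , v , u≢v , σu , σv , ¬uv) = u , v , u≢v , ∖-∉ σ y σu , ∖-∉ σ y σv , ¬uv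

  Face-∖∪ : ∀ {σ : VSet m n} {u v z} → u ≢ v → u ≢ z → v ≢ z → σ v ≡ false → ¬ Adj u v →
            Face ((σ ∖ u) ∪｛ z ｝)
  Face-∖∪ {σ} {u} {v} {z} u≢v u≢z v≢z σv ¬uv =
    u , v , u≢v , ∪-∉ (σ ∖ u) z u≢z (∖-self σ u) , ∪-∉ (σ ∖ u) z v≢z (∖-∉ σ u σv) , ¬uv

  ¬Face-of-adjacent-complement : ∀ {σ : VSet m n} {a b} →
    (∀ w → σ w ≡ false → w ≡ a ⊎ w ≡ b) → Adj a b → ¬ Face σ
  ¬Face-of-adjacent-complement {σ} {a} {b} σᶜ⊆ab ab (u , v , u≢v , σu , σv , ¬uv) =
    go (σᶜ⊆ab u σu) (σᶜ⊆ab v σv)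
    where
    go : u ≡ a ⊎ u ≡ b → v ≡ a ⊎ v ≡ b → ⊥
    go (inj₁ refl) (inj₁ refl) = u≢v refl
    go (inj₁ refl) (inj₂ refl) = ¬uv ab
    go (inj₂ refl) (inj₁ refl) = ¬uv (Adj-sym ab)
    go (inj₂ refl) (inj₂ refl) = u≢v refl

  ∖∪-complement : ∀ {σ : VSet m n} {y z b} → (∀ w → σ w ≡ false → w ≡ z ⊎ w ≡ b) →
                  ∀ w → ((σ ∖ y) ∪｛ z ｝) w ≡ false → w ≡ y ⊎ w ≡ b
  ∖∪-complement {σ} {y} {z} σᶜ⊆zb w τw with ∪-∉⁻ (σ ∖ y) z τw
  ... | w≢z , σ∖y-w with ∖-∉⁻ σ y σ∖y-w
  ...   | inj₁ w≡y = inj₁ w≡y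
  ...   | inj₂ σw with σᶜ⊆zb w σw
  ...     | inj₁ w≡z = contradiction w≡z w≢z
  ...     | inj₂ w≡b = inj₂ w≡b

module Sequence {m n : ℕ} (x : ℕ → V m n) where

  C-resp : ∀ k {σ τ : VSet m n} → σ ≐ τ → C x k σ → C x k τ
  C-resp zero σ≐τ (u , v , u≢v , σu , σv , ¬uv) =
    u , v , u≢v , trans (sym (σ≐τ u)) σu , trans (sym (σ≐τ v)) σv , ¬uv
  C-resp (suc k) σ≐τ (c , unmatched) =
    C-resp k σ≐τ c ,
    λ (c∖ , c∪) → unmatched ( C-resp k (∖-≐ (x k) (sym ∘ σ≐τ)) c∖
                             , C-resp k (∪-≐ (x k) (sym ∘ σ≐τ)) c∪)

  C-anti : ∀ {l k} {σ : VSet m n} → l ≤ k → C x k σ → C x l σ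
  C-anti {k = zero} z≤n c = c
  C-anti {k = suc k} l≤k+1 c with m≤n⇒m<n∨m≡n l≤k+1
  ... | inj₁ (s≤s l≤k) = C-anti l≤k (proj₁ c)
  ... | inj₂ refl      = c

  ¬C₁ : ∀ {τ : VSet m n} → Face (τ ∪｛ x 0 ｝) → ¬ C x 1 τ
  ¬C₁ {τ} face (faceτ , unmatched) = unmatched (Face-∖ (x 0) faceτ , face)

  C-persist : ∀ K {σ : VSet m n} → C x 1 σ →
              (∀ k → 1 ≤ k → k < K → ¬ C x 1 (σ ∖ x k)) → C x K σ
  C-persist zero          c₁ _ = proj₁ c₁
  C-persist (suc zero)    c₁ _ = c₁
  C-persist (suc (suc K)) c₁ unmatched =
    C-persist (suc K) c₁ (λ k 1≤k k<K → unmatched k 1≤k (m≤n⇒m≤1+n k<K)) ,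
    λ (c∖ , _) → unmatched (suc K) (s≤s z≤n) ≤-refl (C-anti (s≤s z≤n) c∖)

  C-pair-drops-out : ∀ K {σ : VSet m n} → σ (x K) ≡ true → C x K σ → C x K (σ ∖ x K) →
                     ¬ C x (suc K) σ × ¬ C x (suc K) (σ ∖ x K)
  C-pair-drops-out K {σ} σx cσ cσ∖ =
    (λ (_ , unmatched) → unmatched (cσ∖ , C-resp K (∪-absorb σ σx) cσ)) ,
    (λ (_ , unmatched) → unmatched ( C-resp K (∖-idem σ (x K)) cσ∖
                                   , C-resp K (∖-∪-restore σ σx) cσ))

  drop-out-at : ∀ K {σ : VSet m n} {y v} → x K ≡ y →
                (∀ k → 1 ≤ k → k < K → x k ≢ v × x k ≢ x 0 × ¬ Adj (x k) v) → v ≢ x 0 →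
                σ v ≡ false → σ y ≡ true → C x 1 σ → C x 1 (σ ∖ y) →
                ¬ C x (suc K) σ × ¬ C x (suc K) (σ ∖ y)
  drop-out-at K {σ} {v = v} refl far v≢x₀ σv σy c₁ c₁∖ =
    C-pair-drops-out K σy (persist σv c₁) (persist (∖-∉ σ (x K) σv) c₁∖)
    where
    persist : ∀ {τ} → τ v ≡ false → C x 1 τ → C x K τ
    persist {τ} τv c = C-persist K c λ k 1≤k k<K →
      let (xk≢v , xk≢x₀ , ¬adj) = far k 1≤k k<K in ¬C₁ (Face-∖∪ xk≢v xk≢x₀ v≢x₀ τv ¬adj)

module PathOrder (m' n' : ℕ) where

  open Sequence (xOrd {m'} {n'}) public

  X : ℕ → V (suc m') (suc n')
  X = xOrd

  col-X : ∀ {k} → k < suc n' → toℕ (proj₂ (X k)) ≡ k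
  col-X k<n = trans (toℕ-fromℕ< _) (m<n⇒m%n≡m k<n)

  X-toℕ : (j : Fin (suc n')) → X (toℕ j) ≡ (zero , j)
  X-toℕ j = cong (zero ,_) (toℕ-injective (col-X (toℕ<n j)))

  X≢X₀ : ∀ {k} → 1 ≤ k → k < suc n' → X k ≢ X 0
  X≢X₀ 1≤k k<n e = <⇒≢ 1≤k (sym (trans (sym (col-X k<n)) (cong (toℕ ∘ proj₂) e)))

  X-col≢ : ∀ {k} {i : Fin (suc m')} {j} → k < suc n' → k ≢ toℕ j → X k ≢ (i , j)
  X-col≢ k<n k≢j e = k≢j (trans (sym (col-X k<n)) (cong toℕ (,-injectiveʳ e)))

  zero≢ : ∀ {i : Fin (suc m')} → 1 ≤ toℕ i → zero ≢ i
  zero≢ 1≤i = <⇒≢ 1≤i ∘ cong toℕ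

  part-i : (σ : VSet (suc m') (suc n')) → CG m' n' 1 σ →
    (j : Fin (suc n')) → 1 ≤ toℕ j →
    ((v : V (suc m') (suc n')) → (σ v ≡ false → (v ≡ (zero , zero) ⊎ v ≡ (zero , j)))
                                × ((v ≡ (zero , zero) ⊎ v ≡ (zero , j)) → σ v ≡ false)) →
    ¬ CG m' n' (toℕ j) σ × ¬ CG m' n' (toℕ j) (σ ∖ (zero , pred j))
  -- For j = 1 the complement {(0,0),(0,1)} of σ is an edge, so σ is not even a face.
  part-i σ c₁ (suc zero) _ σᶜ≡ =
    ⊥-elim (¬Face-of-adjacent-complement (proj₁ ∘ σᶜ≡) (Adj-inject₁-suc zero) (proj₁ c₁))
  part-i σ c₁ j@(suc k@(suc _)) _ σᶜ≡ =
    drop-out-at (toℕ k) X-K≡y far v≢X₀ (proj₂ (σᶜ≡ v) (inj₂ refl)) σy c₁ c₁∖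
    where
    y v : V (suc m') (suc n')
    y = (zero , inject₁ k)
    v = (zero , j)
    X-K≡y : X (toℕ k) ≡ y
    X-K≡y = trans (cong X (sym (toℕ-inject₁ k))) (X-toℕ (inject₁ k))
    y∉σᶜ : ¬ (y ≡ (zero , zero) ⊎ y ≡ v)
    y∉σᶜ (inj₁ ())
    y∉σᶜ (inj₂ y≡v) = proj₁ (Adj-inject₁-suc k) y≡v
    σy : σ y ≡ true
    σy = ¬-not (y∉σᶜ ∘ proj₁ (σᶜ≡ y))
    c₁∖ : C X 1 (σ ∖ y)
    c₁∖ = Face-∖ y (proj₁ c₁) , λ (_ , face) →
      ¬Face-of-adjacent-complement (∖∪-complement (proj₁ ∘ σᶜ≡)) (Adj-inject₁-suc k) face
    v≢X₀ : v ≢ X 0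
    v≢X₀ ()
    far : ∀ l → 1 ≤ l → l < toℕ k → X l ≢ v × X l ≢ X 0 × ¬ Adj (X l) v
    far l 1≤l l<k = X-col≢ l<n (<⇒≢ (<-trans l<k (n<1+n _))) , X≢X₀ 1≤l l<n ,
                    ¬Adj-apart (subst (λ c → suc c < toℕ j) (sym (col-X l<n)) (s≤s l<k))
      where
      l<n : l < suc n'
      l<n = <-trans (<-trans l<k (n<1+n _)) (toℕ<n j)

  part-ii : (σ : VSet (suc m') (suc n')) → CG m' n' 1 σ →
    (i : Fin (suc m')) → (j : Fin (suc n')) → 1 ≤ toℕ i → 1 ≤ toℕ j →
    ((k : Fin (suc n')) → 1 ≤ toℕ k → toℕ k ≤ toℕ j → σ (zero , k) ≡ true) →
    σ (i , j) ≡ false → CG m' n' 1 (σ ∖ (zero , j)) →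
    ¬ CG m' n' (suc (toℕ j)) σ × ¬ CG m' n' (suc (toℕ j)) (σ ∖ (zero , j))
  part-ii σ c₁ i j 1≤i 1≤j row⊆σ σij c₁∖ =
    drop-out-at (toℕ j) (X-toℕ j) far (zero≢ 1≤i ∘ sym ∘ ,-injectiveˡ) σij
                (row⊆σ j 1≤j ≤-refl) c₁ c₁∖
    where
    far : ∀ l → 1 ≤ l → l < toℕ j → X l ≢ (i , j) × X l ≢ X 0 × ¬ Adj (X l) (i , j)
    far l 1≤l l<j = X-col≢ l<n (<⇒≢ l<j) , X≢X₀ 1≤l l<n ,
                    ¬Adj-diagonal (zero≢ 1≤i) (X-col≢ l<n (<⇒≢ l<j) ∘ cong (zero ,_))
      where
      l<n : l < suc n'
      l<n = <-trans l<j (toℕ<n j)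

open PathOrder using (part-i; part-ii; C-anti)

proposition3p11 : (m' n' : ℕ) → (σ : VSet (suc m') (suc n')) → CG m' n' 1 σ →
    ((j : Fin (suc n')) → 1 ≤ toℕ j →
      ((v : V (suc m') (suc n')) → (σ v ≡ false → (v ≡ (zero , zero) ⊎ v ≡ (zero , j)))
                                  × ((v ≡ (zero , zero) ⊎ v ≡ (zero , j)) → σ v ≡ false)) →
      ¬ CG m' n' (toℕ j) σ × ¬ CG m' n' (toℕ j) (σ ∖ (zero , pred j))
        × ¬ CG m' n' (suc n') σ × ¬ CG m' n' (suc n') (σ ∖ (zero , pred j)))
    ×
    ((i : Fin (suc m')) → (j : Fin (suc n')) → 1 ≤ toℕ i → 1 ≤ toℕ j →
      ((k : Fin (suc n')) → 1 ≤ toℕ k → toℕ k ≤ toℕ j → σ (zero , k) ≡ true) →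
      σ (zero , zero) ≡ false → σ (i , j) ≡ false →
      CG m' n' 1 (σ ∖ (zero , j)) →
      ¬ CG m' n' (suc n') σ × ¬ CG m' n' (suc n') (σ ∖ (zero , j)))
proposition3p11 m' n' σ c₁ = (λ j 1≤j σᶜ≡ →
    let (¬cσ , ¬cσ∖) = part-i m' n' σ c₁ j 1≤j σᶜ≡
    in ¬cσ , ¬cσ∖ , ¬cσ ∘ C-anti m' n' (<⇒≤ (toℕ<n j)) , ¬cσ∖ ∘ C-anti m' n' (<⇒≤ (toℕ<n j)))
  -- (ii) does not need (0,0) ∉ σ: the vertex (i,j) alone keeps σ alive up to C_j.
  , λ i j 1≤i 1≤j row⊆σ _ σij c₁∖ →
    let (¬cσ , ¬cσ∖) = part-ii m' n' σ c₁ i j 1≤i 1≤j row⊆σ σij c₁∖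
    in ¬cσ ∘ C-anti m' n' (toℕ<n j) , ¬cσ∖ ∘ C-anti m' n' (toℕ<n j)
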